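{- Every star book is line $[B,A]$-nice.
   Context: For $m\ge1$ and $n_1,n_2\in\mathbb N$, an $(m,n_1,n_2)$-star book consists of the complete bipartite graph $K_{2,m}$ with parts $\{v_1,v_2\}$ and $\{w_1,\dots,w_m\}$, the additional edge $v_1v_2$, $n_1$ leaves attached to $v_1$ and $n_2$ leaves attached to $v_2$. In the $[B,A]$-edge colouring game with $k$ colours, Bob and Alice alternately colour a previously uncoloured edge with one of $k$ colours so that edges sharing an endpoint get distinct colours; Bob moves first; Alice (only) may skip any of her moves. The game ends when no move is possible; Alice wins iff all edges are coloured. A graph $G$ is line $[B,A]$-nice if the least $k$ for which Alice has a winning strategy equals $\omega(L(G))$, the maximum number of pairwise adjacent edges of $G$. -}

module Defs where

open import Data.Nat using (ℕ; _≤_; _<_)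
open import Data.Fin using (Fin)
open import Data.Maybe using (Maybe; just; nothing)
open import Data.Product using (Σ; Σ-syntax; ∃; _×_; _,_)
open import Data.Sum using (_⊎_)
open import Data.List using (List; length)
open import Data.List.Relation.Unary.AllPairs using (AllPairs)
open import Relation.Nullary using (¬_)
open import Relation.Binary.PropositionalEquality using (_≡_; _≢_)

record Graph : Set₁ where
  field
    Vtx  : Set
    Edge : Set
    ends : Edge → Vtx × Vtx

module _ (G : Graph) where
  open Graph G

  ShareEnd : Edge → Edge → Set
  ShareEnd e e' with ends e | ends e'
  ... | (x , y) | (x' , y') = (x ≡ x') ⊎ (x ≡ y') ⊎ (y ≡ x') ⊎ (y ≡ y')

  -- adjacency in the line graph L(G): distinct edges sharing an endpoint
  AdjE : Edge → Edge → Set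
  AdjE e e' = e ≢ e' × ShareEnd e e'

  LineClique : List Edge → Set
  LineClique xs = AllPairs AdjE xs

  IsLineCliqueNumber : ℕ → Set
  IsLineCliqueNumber w =
    (Σ[ xs ∈ List Edge ] (LineClique xs × length xs ≡ w)) ×
    (∀ xs → LineClique xs → length xs ≤ w)

  module Game (k : ℕ) where

    Position : Set
    Position = Edge → Maybe (Fin k)

    Legal : Position → Edge → Fin k → Set
    Legal p e c = (p e ≡ nothing) × (∀ e' → e' ≢ e → ShareEnd e e' → p e' ≢ just c)

    Step : Position → Edge → Fin k → Position → Set
    Step p e c p' = Legal p e c × (p' e ≡ just c) × (∀ e' → e' ≢ e → p' e' ≡ p e')

    NoMove : Position → Set
    NoMove p = ∀ e c → ¬ Legal p e c

    MoveExists : Position → Set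
    MoveExists p = Σ[ e ∈ Edge ] Σ[ c ∈ Fin k ] Legal p e c

    Complete : Position → Set
    Complete p = ∀ e → Σ[ c ∈ Fin k ] (p e ≡ just c)

    -- Alice can force a win from p when it is Bob's (resp. Alice's) turn.
    data WinB (p : Position) : Set
    data WinA (p : Position) : Set

    data WinB p where
      over : NoMove p → Complete p → WinB p
      bob  : MoveExists p →
             (∀ e c p' → Step p e c p' → WinA p') → WinB p

    data WinA p where
      over : NoMove p → Complete p → WinA p
      move : ∀ e c p' → Step p e c p' → WinB p' → WinA p
      skip : WinB p → WinA p

    empty : Position
    empty _ = nothing

  AliceWins : ℕ → Set
  AliceWins k = Game.WinB k (Game.empty k)

  LineBANice : Set
  LineBANice = Σ[ w ∈ ℕ ] (IsLineCliqueNumber w × AliceWins w ×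
                          (∀ k → k < w → ¬ AliceWins k))

data SBVtx (m n₁ n₂ : ℕ) : Set where
  v₁ v₂ : SBVtx m n₁ n₂
  w     : Fin m  → SBVtx m n₁ n₂   -- the vertices w_i of K_{2,m}
  leaf₁ : Fin n₁ → SBVtx m n₁ n₂
  leaf₂ : Fin n₂ → SBVtx m n₁ n₂

data SBEdge (m n₁ n₂ : ℕ) : Set where
  e₁₂  : SBEdge m n₁ n₂
  e₁w  : Fin m  → SBEdge m n₁ n₂
  e₂w  : Fin m  → SBEdge m n₁ n₂
  e₁ℓ  : Fin n₁ → SBEdge m n₁ n₂
  e₂ℓ  : Fin n₂ → SBEdge m n₁ n₂

sbEnds : ∀ {m n₁ n₂} → SBEdge m n₁ n₂ → SBVtx m n₁ n₂ × SBVtx m n₁ n₂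
sbEnds e₁₂     = v₁ , v₂
sbEnds (e₁w i) = v₁ , w i
sbEnds (e₂w i) = v₂ , w i
sbEnds (e₁ℓ j) = v₁ , leaf₁ j
sbEnds (e₂ℓ j) = v₂ , leaf₂ j

starBook : ℕ → ℕ → ℕ → Graph
starBook m n₁ n₂ = record
  { Vtx  = SBVtx m n₁ n₂
  ; Edge = SBEdge m n₁ n₂
  ; ends = sbEnds
  }

{-# OPTIONS --safe #-}
-- ω(L(G)) = max(3, deg v₁, deg v₂): a clique of L(G) lies in the star at v₁, in the star at
-- v₂, or in a triangle v₁v₂, v₁wᵢ, v₂wᵢ. Any final position is a proper colouring, so with
-- fewer colours Alice cannot complete it.
--
-- With ω colours, say deg v₂ ≤ deg v₁. Alice pairs edges at v₁ with non-adjacent edges at v₂,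
-- so that every edge at v₂ (and every edge at v₁ if the degrees are equal) has a partner, and
-- answers each move of Bob on the partner edge, with the same colour whenever possible. Partners
-- are thus coloured together and every colour used at v₂ is also used at v₁ (and conversely if
-- the degrees are equal). An edge at v₁ then sees only colours of the star at v₁, at most
-- deg v₁ − 1 of them; an edge at v₂ sees at most deg v₂ colours, fewer than ω unless the degrees
-- are equal, when the converse invariant applies. So the game ends only when all edges are
-- coloured. For the triangle (one page, no leaves) three colours trivially suffice.

module Submission where

open import Defs
open import Data.Nat using (ℕ; zero; suc; _+_; _⊔_; _≤_; _<_; _≤?_; _<?_; z≤n; s≤s)
  renaming (_≟_ to _≟ℕ_)
open import Data.Nat.Properties
  using (≤-refl; ≤-trans; <-trans; <-≤-trans; <⇒≤; ≰⇒>; <-irrefl; ≤-pred; 1+n≢n; m≤n⇒m<n∨m≡n;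
         +-suc; +-mono-≤; +-mono-<-≤; +-mono-≤-<; +-monoʳ-<;
         ⊔-sel; m≤m⊔n; m≤n⊔m; m≤n⇒m⊔n≡n; m≥n⇒m⊔n≡m; module ≤-Reasoning)
open import Data.Nat.ListAction using (sum)
open import Data.Fin using (Fin; zero; suc; toℕ; fromℕ; fromℕ<; inject₁; lower₁)
open import Data.Fin.Properties
  using (¬∀⟶∃¬; toℕ-injective; toℕ<n; toℕ-fromℕ; toℕ-fromℕ<; toℕ-lower₁; toℕ-inject₁-≢;
         inject₁-lower₁; lower₁-inject₁′)
  renaming (_≟_ to _≟ᶠ_)
open import Data.Maybe using (Maybe; just; nothing)
open import Data.Maybe.Properties using (just-injective) renaming (≡-dec to ≡-decᵐ)
open import Data.Product using (∃-syntax; _×_; _,_; proj₁; proj₂)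
open import Data.Sum as Sum using (_⊎_; inj₁; inj₂)
open import Data.Empty using (⊥-elim)
open import Data.Unit using (⊤; tt)
open import Data.List using (List; []; _∷_; length; map; _++_; _?∷_; allFin)
open import Data.List.Properties using (length-++; length-map; length-tabulate)
open import Data.List.Relation.Unary.All as All using (All; []; _∷_; all?)
open import Data.List.Relation.Unary.All.Properties as Allₚ using (¬All⇒Any¬)
open import Data.List.Relation.Unary.Any using (here; there; any?)
open import Data.List.Relation.Unary.AllPairs as AllPairs using (AllPairs; []; _∷_)
open import Data.List.Relation.Unary.Unique.Propositional using (Unique)
import Data.List.Relation.Unary.Unique.Propositional.Properties as Unique
open import Data.List.Membership.Propositional using (_∈_; _∉_; find; lose)
open import Data.List.Membership.Propositional.Properties
  using (∈-map⁺; ∈-map⁻; ∈-++⁺ˡ; ∈-++⁺ʳ; ∈-++⁻; ∈-∃++; ∈-allFin)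
import Data.List.Membership.DecPropositional as DecMembership
open import Relation.Nullary using (¬_; yes; no)
open import Relation.Nullary.Decidable using (map′)
open import Relation.Nullary.Negation using (contradiction)
open import Relation.Binary.PropositionalEquality
  using (_≡_; _≢_; refl; sym; trans; cong; cong₂; subst; ≢-sym)
open import Relation.Binary.Definitions using (DecidableEquality)
open import Function using (_∘_; case_of_)

module _ {A : Set} where

  unique-⊆⇒length-≤ : ∀ {xs ys : List A} → Unique xs → (∀ {x} → x ∈ xs → x ∈ ys) →
                      length xs ≤ length ys
  unique-⊆⇒length-≤ {[]} _ _ = z≤n
  unique-⊆⇒length-≤ {x ∷ xs} (x∉xs ∷ xs!) xs⊆ys with ∈-∃++ (xs⊆ys (here refl))
  ... | us , vs , refl = subst (suc (length xs) ≤_) (sym length-us++x∷vs)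
                           (s≤s (unique-⊆⇒length-≤ xs! xs⊆us++vs))
    where
    length-us++x∷vs : length (us ++ x ∷ vs) ≡ suc (length (us ++ vs))
    length-us++x∷vs = trans (length-++ us) (trans (+-suc (length us) (length vs))
                        (cong suc (sym (length-++ us))))
    xs⊆us++vs : ∀ {z} → z ∈ xs → z ∈ us ++ vs
    xs⊆us++vs z∈xs with ∈-++⁻ us (xs⊆ys (there z∈xs))
    ... | inj₁ z∈us         = ∈-++⁺ˡ z∈us
    ... | inj₂ (here refl)  = contradiction refl (All.lookup x∉xs z∈xs)
    ... | inj₂ (there z∈vs) = ∈-++⁺ʳ us z∈vs

  sum-map-mono-≤ : ∀ {f g : A → ℕ} → (∀ x → f x ≤ g x) → ∀ xs → sum (map f xs) ≤ sum (map g xs)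
  sum-map-mono-≤ f≤g []       = z≤n
  sum-map-mono-≤ f≤g (x ∷ xs) = +-mono-≤ (f≤g x) (sum-map-mono-≤ f≤g xs)

  sum-map-mono-< : ∀ {f g : A → ℕ} → (∀ x → f x ≤ g x) → ∀ {e} xs → e ∈ xs → f e < g e →
                   sum (map f xs) < sum (map g xs)
  sum-map-mono-< f≤g (x ∷ xs) (here refl)  fe<ge = +-mono-<-≤ fe<ge (sum-map-mono-≤ f≤g xs)
  sum-map-mono-< f≤g (x ∷ xs) (there e∈xs) fe<ge = +-mono-≤-< (f≤g x) (sum-map-mono-< f≤g xs e∈xs fe<ge)

free-colour : ∀ {k} (ys : List (Maybe (Fin k))) → length ys ≤ k → nothing ∈ ys →
              ∃[ c ] just c ∉ ys
free-colour {k} ys ys≤k nothing∈ys =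
  ¬∀⟶∃¬ k (λ c → just c ∈ ys) (λ c → just c ∈? ys) all-colours-used⇒⊥
  where
  open DecMembership (≡-decᵐ (_≟ᶠ_ {k})) using (_∈?_)
  slots : List (Maybe (Fin k))
  slots = nothing ∷ map just (allFin k)
  slots! : Unique slots
  slots! = All.tabulate nothing≢ ∷ Unique.map⁺ just-injective (Unique.allFin⁺ k)
    where
    nothing≢ : ∀ {y} → y ∈ map just (allFin k) → nothing ≢ y
    nothing≢ y∈ with ∈-map⁻ just y∈
    ... | _ , _ , refl = λ ()
  all-colours-used⇒⊥ : ¬ (∀ c → just c ∈ ys)
  all-colours-used⇒⊥ used = <-irrefl refl (begin-strict
      k                            ≡⟨ sym (trans (length-map just (allFin k)) (length-tabulate (λ c → c))) ⟩
      length (map just (allFin k)) <⟨ ≤-refl ⟩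
      length slots                 ≤⟨ unique-⊆⇒length-≤ slots! slots⊆ys ⟩
      length ys                    ≤⟨ ys≤k ⟩
      k                            ∎)
    where
    open ≤-Reasoning
    slots⊆ys : ∀ {y} → y ∈ slots → y ∈ ys
    slots⊆ys (here refl) = nothing∈ys
    slots⊆ys (there y∈) with ∈-map⁻ just y∈
    ... | c , _ , refl = used c

next : ∀ {n} → Fin (suc n) → Fin (suc n)
next {n} i with n ≟ℕ toℕ i
... | yes _   = zero
... | no  n≢i = suc (lower₁ i n≢i)

prev : ∀ {n} → Fin (suc n) → Fin (suc n)
prev zero    = fromℕ _
prev (suc i) = inject₁ i

prev-next : ∀ {n} (i : Fin (suc n)) → prev (next i) ≡ i
prev-next {n} i with n ≟ℕ toℕ i
... | yes n≡i = toℕ-injective (trans (toℕ-fromℕ n) n≡i)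
... | no  n≢i = inject₁-lower₁ i n≢i

next-prev : ∀ {n} (i : Fin (suc n)) → next (prev i) ≡ i
next-prev {n} zero with n ≟ℕ toℕ (fromℕ n)
... | yes _   = refl
... | no  n≢n = contradiction (sym (toℕ-fromℕ n)) n≢n
next-prev {n} (suc i) with n ≟ℕ toℕ (inject₁ i)
... | yes n≡i = contradiction n≡i (toℕ-inject₁-≢ i)
... | no  n≢i = cong suc (lower₁-inject₁′ i n≢i)

next-≢ : ∀ {n} (i : Fin (suc (suc n))) → next i ≢ i
next-≢ {n} i with suc n ≟ℕ toℕ i
... | yes n≡i = λ 0≡i → contradiction (trans n≡i (cong toℕ (sym 0≡i))) λ ()
... | no  n≢i = λ next≡i → 1+n≢n (trans (cong suc (sym (toℕ-lower₁ i n≢i))) (cong toℕ next≡i))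

module _ {a b : ℕ} {E : Set} (f : Fin b → E) where

  matchIndex : Fin a → Maybe E
  matchIndex j with toℕ j <? b
  ... | yes j<b = just (f (fromℕ< j<b))
  ... | no  _   = nothing

  matchIndex-just : ∀ {j e} → matchIndex j ≡ just e → ∃[ j′ ] toℕ j ≡ toℕ j′ × f j′ ≡ e
  matchIndex-just {j} eq with toℕ j <? b
  matchIndex-just refl | yes j<b = fromℕ< j<b , sym (toℕ-fromℕ< j<b) , refl

  matchIndex-of : ∀ {j j′} → toℕ j ≡ toℕ j′ → matchIndex j ≡ just (f j′)
  matchIndex-of {j} {j′} j≡j′ with toℕ j <? b
  ... | yes j<b = cong (just ∘ f) (toℕ-injective (trans (toℕ-fromℕ< j<b) j≡j′))
  ... | no  j≮b = contradiction (subst (_< b) (sym j≡j′) (toℕ<n j′)) j≮b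

  matchIndex-total : ∀ {j} → toℕ j < b → ∃[ e ] matchIndex j ≡ just e
  matchIndex-total j<b = _ , matchIndex-of (sym (toℕ-fromℕ< j<b))

module _ (G : Graph) where
  open Graph G

  data Through (v : Vtx) (e : Edge) : Set where
    first  : proj₁ (ends e) ≡ v → Through v e
    second : proj₂ (ends e) ≡ v → Through v e

  private
    endpoint : ∀ {v e x y} → Through v e → ends e ≡ (x , y) → x ≡ v ⊎ y ≡ v
    endpoint (first  p) ends≡ = inj₁ (trans (sym (cong proj₁ ends≡)) p)
    endpoint (second p) ends≡ = inj₂ (trans (sym (cong proj₂ ends≡)) p)

  shareEnd⇒through : ∀ {e e′} → ShareEnd G e e′ → ∃[ v ] Through v e × Through v e′
  shareEnd⇒through {e} {e′} s with ends e in ends≡ | ends e′ in ends≡′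
  ... | x , y | x′ , y′ = meet s
    where
    meet : (x ≡ x′) ⊎ (x ≡ y′) ⊎ (y ≡ x′) ⊎ (y ≡ y′) → ∃[ v ] Through v e × Through v e′
    meet (inj₁ refl)               = x , first (cong proj₁ ends≡) , first  (cong proj₁ ends≡′)
    meet (inj₂ (inj₁ refl))        = x , first (cong proj₁ ends≡) , second (cong proj₂ ends≡′)
    meet (inj₂ (inj₂ (inj₁ refl))) = y , second (cong proj₂ ends≡) , first  (cong proj₁ ends≡′)
    meet (inj₂ (inj₂ (inj₂ refl))) = y , second (cong proj₂ ends≡) , second (cong proj₂ ends≡′)

  through⇒shareEnd : ∀ {v e e′} → Through v e → Through v e′ → ShareEnd G e e′
  through⇒shareEnd {v} {e} {e′} t t′ with ends e in ends≡ | ends e′ in ends≡′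
  ... | x , y | x′ , y′ = meet (endpoint t ends≡) (endpoint t′ ends≡′)
    where
    meet : (x ≡ v ⊎ y ≡ v) → (x′ ≡ v ⊎ y′ ≡ v) → (x ≡ x′) ⊎ (x ≡ y′) ⊎ (y ≡ x′) ⊎ (y ≡ y′)
    meet (inj₁ refl) (inj₁ refl) = inj₁ refl
    meet (inj₁ refl) (inj₂ refl) = inj₂ (inj₁ refl)
    meet (inj₂ refl) (inj₁ refl) = inj₂ (inj₂ (inj₁ refl))
    meet (inj₂ refl) (inj₂ refl) = inj₂ (inj₂ (inj₂ refl))

  shareEnd-sym : ∀ {e e′} → ShareEnd G e e′ → ShareEnd G e′ e
  shareEnd-sym s = let _ , t , t′ = shareEnd⇒through s in through⇒shareEnd t′ t

  adjE-sym : ∀ {e e′} → AdjE G e e′ → AdjE G e′ e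
  adjE-sym (e≢e′ , s) = ≢-sym e≢e′ , shareEnd-sym s

  clique-adjacent : ∀ {xs x y} → LineClique G xs → x ∈ xs → y ∈ xs → x ≢ y → AdjE G x y
  clique-adjacent (_ ∷ _)        (here refl) (here refl) x≢y = contradiction refl x≢y
  clique-adjacent (x~xs ∷ _)     (here refl) (there y∈)  _   = All.lookup x~xs y∈
  clique-adjacent (y~xs ∷ _)     (there x∈)  (here refl) _   = adjE-sym (All.lookup y~xs x∈)
  clique-adjacent (_ ∷ clique)   (there x∈)  (there y∈)  x≢y = clique-adjacent clique x∈ y∈ x≢y

  unique-star⇒clique : ∀ {xs} → Unique xs → (∀ {x y} → x ∈ xs → y ∈ xs → ShareEnd G x y) →
                       LineClique G xs
  unique-star⇒clique []           _     = []
  unique-star⇒clique (x∉ ∷ xs!) share =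
    All.tabulate (λ y∈ → All.lookup x∉ y∈ , share (here refl) (there y∈)) ∷
    unique-star⇒clique xs! (λ x∈ y∈ → share (there x∈) (there y∈))

module Moves (G : Graph) (_≟_ : DecidableEquality (Graph.Edge G)) (k : ℕ) where
  open Graph G
  open Game G k

  colour : Position → Edge → Fin k → Position
  colour p e c x with x ≟ e
  ... | yes _ = just c
  ... | no  _ = p x

  colour-step : ∀ {p e c} → Legal p e c → Step p e c (colour p e c)
  colour-step {p} {e} {c} legal = legal , coloured , unchanged
    where
    coloured : colour p e c e ≡ just c
    coloured with e ≟ e
    ... | yes _  = refl
    ... | no e≢e = contradiction refl e≢e
    unchanged : ∀ x → x ≢ e → colour p e c x ≡ p x
    unchanged x x≢e with x ≟ e
    ... | yes x≡e = contradiction x≡e x≢e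
    ... | no  _   = refl

  coloured≢blank : ∀ {p : Position} {x y d} → p x ≡ just d → p y ≡ nothing → x ≢ y
  coloured≢blank px≡d py≡nothing refl = contradiction (trans (sym px≡d) py≡nothing) λ ()

  ColoursWithin : Position → List Edge → List Edge → Set
  ColoursWithin p A B = ∀ {x d} → x ∈ A → p x ≡ just d → just d ∈ map p B

  colour-on : ∀ {p : Position} {x d} (B : List Edge) → x ∈ B → p x ≡ just d → just d ∈ map p B
  colour-on {p} B x∈B px≡d = subst (_∈ map p B) px≡d (∈-map⁺ p x∈B)

  module _ {p e c q} (step : Step p e c q) where

    step-unchanged : ∀ {x} → x ≢ e → q x ≡ p x
    step-unchanged x≢e = proj₂ (proj₂ step) _ x≢e

    step-unchanged-colour : ∀ {x d} → x ≢ e → q x ≡ just d → p x ≡ just d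
    step-unchanged-colour x≢e qx≡d = trans (sym (step-unchanged x≢e)) qx≡d

    step-new : ∀ {x d} → q x ≡ just d → (x ≡ e × d ≡ c) ⊎ p x ≡ just d
    step-new {x} qx≡d with x ≟ e
    ... | yes refl = inj₁ (refl , just-injective (trans (sym qx≡d) (proj₁ (proj₂ step))))
    ... | no  x≢e  = inj₂ (step-unchanged-colour x≢e qx≡d)

    step-keeps : ∀ {x d} → p x ≡ just d → q x ≡ just d
    step-keeps {x} px≡d with x ≟ e
    ... | yes refl = ⊥-elim (coloured≢blank {p} px≡d (proj₁ (proj₁ step)) refl)
    ... | no  x≢e  = trans (step-unchanged x≢e) px≡d

    step-blank : ∀ {x} → q x ≡ nothing → x ≢ e × p x ≡ nothing
    step-blank qx≡nothing = x≢e , trans (sym (step-unchanged x≢e)) qx≡nothing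
      where
      x≢e : _ ≢ e
      x≢e refl = coloured≢blank {q} (proj₁ (proj₂ step)) qx≡nothing refl

    step-keeps-colour-on : ∀ {d} (B : List Edge) → just d ∈ map p B → just d ∈ map q B
    step-keeps-colour-on B d∈B with ∈-map⁻ p d∈B
    ... | x , x∈B , d≡px = colour-on B x∈B (step-keeps (sym d≡px))

    within-step : ∀ {A B} → (e ∈ A → just c ∈ map q B) → ColoursWithin p A B → ColoursWithin q A B
    within-step {B = B} new within x∈A qx≡d with step-new qx≡d
    ... | inj₁ (refl , refl) = new x∈A
    ... | inj₂ px≡d          = step-keeps-colour-on B (within x∈A px≡d)

  within-two-steps : ∀ {p e c q f c′ r} {A B : List Edge} → Step p e c q → Step q f c′ r →
                     (e ∈ A → just c ∈ map r B) → (f ∈ A → just c′ ∈ map r B) →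
                     ColoursWithin p A B → ColoursWithin r A B
  within-two-steps {B = B} step step′ new new′ within x∈A rx≡d with step-new step′ rx≡d
  ... | inj₁ (refl , refl) = new′ x∈A
  ... | inj₂ qx≡d with step-new step qx≡d
  ...   | inj₁ (refl , refl) = new x∈A
  ...   | inj₂ px≡d          = step-keeps-colour-on step′ B (step-keeps-colour-on step B (within x∈A px≡d))

  legal-colour : ∀ {p e} (ys : List Edge) → e ∈ ys → length ys ≤ k → p e ≡ nothing →
                 (∀ {e′ d} → AdjE G e e′ → p e′ ≡ just d → just d ∈ map p ys) →
                 ∃[ c ] Legal p e c
  legal-colour {p} {e} ys e∈ys ys≤k pe≡nothing around with
    free-colour (map p ys) (subst (_≤ k) (sym (length-map p ys)) ys≤k)
                (subst (_∈ map p ys) pe≡nothing (∈-map⁺ p e∈ys))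
  ... | c , c∉ys = c , pe≡nothing , λ e′ e′≢e s pe′≡c → c∉ys (around (≢-sym e′≢e , s) pe′≡c)

  Proper : Position → Set
  Proper p = ∀ {x y d} → AdjE G x y → p x ≡ just d → p y ≢ just d

  proper-step : ∀ {p e c q} → Step p e c q → Proper p → Proper q
  proper-step step@((_ , legal) , _) proper {x} {y} (x≢y , s) qx≡d qy≡d
    with step-new step qx≡d | step-new step qy≡d
  ... | inj₁ (refl , refl) | inj₁ (refl , _) = x≢y refl
  ... | inj₁ (refl , refl) | inj₂ py≡d       = legal y (≢-sym x≢y) s py≡d
  ... | inj₂ px≡d          | inj₁ (refl , refl) = legal x x≢y (shareEnd-sym G s) px≡d
  ... | inj₂ px≡d          | inj₂ py≡d       = proper (x≢y , s) px≡d py≡d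

  complete-proper⇒clique-≤ : ∀ {p} → Complete p → Proper p → ∀ {xs} → LineClique G xs → length xs ≤ k
  complete-proper⇒clique-≤ {p} complete proper {xs} clique = begin
    length xs                ≡⟨ sym (length-map colourOf xs) ⟩
    length (map colourOf xs) ≤⟨ unique-⊆⇒length-≤ (distinct clique) (λ {c} _ → ∈-allFin c) ⟩
    length (allFin k)        ≡⟨ length-tabulate (λ c → c) ⟩
    k                        ∎
    where
    open ≤-Reasoning
    colourOf : Edge → Fin k
    colourOf e = proj₁ (complete e)
    distinct : ∀ {xs} → LineClique G xs → Unique (map colourOf xs)
    distinct []                = []
    distinct {x ∷ _} (x~xs ∷ clique) = Allₚ.map⁺ (All.map differ x~xs) ∷ distinct clique
      where
      differ : ∀ {y} → AdjE G x y → colourOf x ≢ colourOf y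
      differ {y} x~y same =
        proper x~y (proj₂ (complete x)) (trans (proj₂ (complete y)) (cong just (sym same)))

  no-win-below-clique : ∀ {xs} → LineClique G xs → k < length xs → ¬ AliceWins G k
  no-win-below-clique {xs} clique k<xs = bob-wins (λ _ ())
    where
    finished : ∀ {p} → Proper p → ¬ Complete p
    finished proper complete =
      <-irrefl refl (<-≤-trans k<xs (complete-proper⇒clique-≤ complete proper clique))
    bob-wins  : ∀ {p} → Proper p → ¬ WinB p
    bob-wins′ : ∀ {p} → Proper p → ¬ WinA p
    bob-wins proper (over _ complete)        = finished proper complete
    bob-wins proper (bob (e , c , legal) wins) =
      bob-wins′ (proper-step (colour-step legal) proper) (wins e c _ (colour-step legal))
    bob-wins′ proper (over _ complete)       = finished proper complete
    bob-wins′ proper (move _ _ _ step wins)  = bob-wins (proper-step step proper) wins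
    bob-wins′ proper (skip wins)             = bob-wins proper wins

  module Play (allE : List Edge) (complete : ∀ e → e ∈ allE) where

    blank : Maybe (Fin k) → ℕ
    blank nothing  = 1
    blank (just _) = 0

    blanks : Position → ℕ
    blanks p = sum (map (λ e → blank (p e)) allE)

    step-blanks : ∀ {p e c q} → Step p e c q → blanks q < blanks p
    step-blanks {p} {e} {q = q} step = sum-map-mono-< fewer allE (complete e) filled
      where
      fewer : ∀ x → blank (q x) ≤ blank (p x)
      fewer x with q x in qx≡
      ... | just _  = z≤n
      ... | nothing rewrite proj₂ (step-blank step qx≡) = ≤-refl
      filled : blank (q e) < blank (p e)
      filled rewrite proj₁ (proj₂ step) | proj₁ (proj₁ step) = s≤s z≤n

    module Invariant
      (Inv : Position → Set)
      (playable : ∀ {p e} → Inv p → p e ≡ nothing → ∃[ c ] Legal p e c)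
      (respond : ∀ {p e c q} → Inv p → Step p e c q →
                 Inv q ⊎ ∃[ e′ ] ∃[ c′ ] ∃[ r ] Step q e′ c′ r × Inv r)
      where

      private
        wins : ∀ n {p} → blanks p < n → Inv p → WinB p
        wins (suc n) {p} p<n inv with any? (λ e → ≡-decᵐ _≟ᶠ_ (p e) nothing) allE
        ... | no none = over (λ e _ legal → none (lose (complete e) (proj₁ legal))) coloured
          where
          coloured : Complete p
          coloured e with p e in pe≡
          ... | just c  = c , refl
          ... | nothing = contradiction (lose (complete e) pe≡) none
        ... | yes some with find some
        ... | e , _ , pe≡nothing with playable inv pe≡nothing
        ... | c , legal = bob (e , c , legal) answer
          where
          answer : ∀ e c q → Step p e c q → WinA q
          answer _ _ q step with respond inv step
          ... | inj₁ inv′ = skip (wins n (≤-trans (step-blanks step) (≤-pred p<n)) inv′)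
          ... | inj₂ (e′ , c′ , r , step′ , inv′) = move e′ c′ r step′
            (wins n (<-trans (step-blanks step′) (≤-trans (step-blanks step) (≤-pred p<n))) inv′)

      aliceWins-from : ∀ {p} → Inv p → WinB p
      aliceWins-from inv = wins _ ≤-refl inv

    aliceWins-few-edges : length allE ≤ k → AliceWins G k
    aliceWins-few-edges allE≤k = Invariant.aliceWins-from (λ _ → ⊤) playable (λ _ _ → inj₁ tt) tt
      where
      playable : ∀ {p e} → ⊤ → p e ≡ nothing → ∃[ c ] Legal p e c
      playable {p} {e} _ pe≡nothing = legal-colour allE (complete e) allE≤k pe≡nothing
        λ {e′} _ pe′≡d → subst (_∈ map p allE) pe′≡d (∈-map⁺ p (complete e′))

-- For the star book: hub = v₁v₂, S and T are the other edges at v₁ and at v₂, and the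
-- rung of v₁wᵢ is v₂wᵢ (and vice versa), the only adjacency between S and T.
record TwoStars (G : Graph) : Set where
  open Graph G
  field
    hub      : Edge
    S T      : List Edge
    hub∉S    : hub ∉ S
    hub∉T    : hub ∉ T
    S∩T≡∅    : ∀ {e} → e ∈ S → e ∉ T
    split    : ∀ e → e ≡ hub ⊎ e ∈ S ⊎ e ∈ T
    star-S   : ∀ {x y} → x ∈ hub ∷ S → y ∈ hub ∷ S → ShareEnd G x y
    star-T   : ∀ {x y} → x ∈ hub ∷ T → y ∈ hub ∷ T → ShareEnd G x y
    rung     : Edge → Maybe Edge
    adjacent : ∀ {e e′} → AdjE G e e′ →
               (e ∈ hub ∷ S × e′ ∈ hub ∷ S) ⊎ (e ∈ hub ∷ T × e′ ∈ hub ∷ T) ⊎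
               (rung e ≡ just e′ × (e ∈ S × e′ ∈ T ⊎ e ∈ T × e′ ∈ S))

  hub∷S∌T : ∀ {e} → e ∈ hub ∷ S → e ∉ T
  hub∷S∌T (here refl) = hub∉T
  hub∷S∌T (there e∈S) = S∩T≡∅ e∈S

  hub∷T∌S : ∀ {e} → e ∈ hub ∷ T → e ∉ S
  hub∷T∌S (here refl) = hub∉S
  hub∷T∌S (there e∈T) e∈S = S∩T≡∅ e∈S e∈T

  swap : TwoStars G
  swap = record
    { hub = hub ; S = T ; T = S ; hub∉S = hub∉T ; hub∉T = hub∉S
    ; S∩T≡∅ = λ e∈T e∈S → S∩T≡∅ e∈S e∈T
    ; split = λ e → Sum.map₂ Sum.swap (split e)
    ; star-S = star-T ; star-T = star-S ; rung = rung
    ; adjacent = λ e~e′ → swap-cases (adjacent e~e′)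
    }
    where
    swap-cases : ∀ {A B C D E : Set} → A ⊎ B ⊎ (C × (D ⊎ E)) → B ⊎ A ⊎ (C × (E ⊎ D))
    swap-cases (inj₁ a)              = inj₂ (inj₁ a)
    swap-cases (inj₂ (inj₁ b))       = inj₁ b
    swap-cases (inj₂ (inj₂ (c , x))) = inj₂ (inj₂ (c , Sum.swap x))

record Pairing {G : Graph} (X : TwoStars G) : Set where
  open Graph G
  open TwoStars X
  field
    partner            : Edge → Maybe Edge
    partner-involutive : ∀ {a b} → partner a ≡ just b → partner b ≡ just a
    partner-crosses    : ∀ {a b} → partner a ≡ just b → a ∈ S × b ∈ T ⊎ a ∈ T × b ∈ S
    partner-not-rung   : ∀ {a b} → partner a ≡ just b → rung a ≢ just b

  swapᵖ : Pairing (TwoStars.swap X)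
  swapᵖ = record
    { partner = partner ; partner-involutive = partner-involutive
    ; partner-crosses = λ pa≡b → Sum.swap (partner-crosses pa≡b)
    ; partner-not-rung = partner-not-rung
    }

module StarSide (G : Graph) (_≟_ : DecidableEquality (Graph.Edge G)) (k : ℕ) (Y : TwoStars G) where
  open Graph G
  open Game G k
  open Moves G _≟_ k
  open TwoStars Y

  star-S-avoids : ∀ {p e c q x} → Step p e c q → e ∈ hub ∷ S → x ∈ hub ∷ S → x ≢ e → p x ≢ just c
  star-S-avoids ((_ , legal) , _) e∈ x∈ x≢e = legal _ x≢e (star-S e∈ x∈)

  star-S-colours : ∀ {p e e′ d} → ColoursWithin p T S → e ∈ hub ∷ S → AdjE G e e′ →
                   p e′ ≡ just d → just d ∈ map p (hub ∷ S)
  star-S-colours within e∈ e~e′@(e≢e′ , _) pe′≡d with adjacent e~e′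
  ... | inj₁ (_ , e′∈)                       = colour-on (hub ∷ S) e′∈ pe′≡d
  ... | inj₂ (inj₁ (here refl , here refl))  = contradiction refl e≢e′
  ... | inj₂ (inj₁ (here refl , there e′∈T)) = there (within e′∈T pe′≡d)
  ... | inj₂ (inj₁ (there e∈T , _))          = contradiction e∈T (hub∷S∌T e∈)
  ... | inj₂ (inj₂ (_ , inj₁ (_ , e′∈T)))    = there (within e′∈T pe′≡d)
  ... | inj₂ (inj₂ (_ , inj₂ (e∈T , _)))     = contradiction e∈T (hub∷S∌T e∈)

  star-S-playable : ∀ {p e} → ColoursWithin p T S → length (hub ∷ S) ≤ k → e ∈ hub ∷ S →
                    p e ≡ nothing → ∃[ c ] Legal p e c
  star-S-playable within S≤k e∈ pe≡nothing =
    legal-colour (hub ∷ S) e∈ S≤k pe≡nothing (star-S-colours within e∈)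

module Mirror (G : Graph) (_≟_ : DecidableEquality (Graph.Edge G))
              (allE : List (Graph.Edge G)) (complete : ∀ e → e ∈ allE)
              (k : ℕ) (X : TwoStars G) (P : Pairing X) where
  open Graph G
  open Game G k
  open Moves G _≟_ k
  open Play allE complete
  open TwoStars X
  open Pairing P
  open StarSide G _≟_ k X
  module Swapped = StarSide G _≟_ k swap
  open DecMembership (≡-decᵐ (_≟ᶠ_ {k})) using (_∈?_)

  Paired : Edge → Set
  Paired e = ∃[ f ] partner e ≡ just f

  data Balance : Set where
    balanced   : length (hub ∷ T) ≤ k → (∀ {e} → e ∈ S → Paired e) → Balance
    unbalanced : length (hub ∷ T) < k → Balance

  Synced : Position → Set
  Synced p = ∀ {a b} → partner a ≡ just b → p a ≡ nothing → p b ≡ nothing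

  Mirrored : Balance → Position → Set
  Mirrored (balanced _ _) p = ColoursWithin p S T
  Mirrored (unbalanced _) p = ⊤

  -- Every colour on T also occurs on S, so the colours around an uncoloured edge of the
  -- star hub ∷ S occur on that star and leave one of its length (≤ k) colours free.
  Inv : Balance → Position → Set
  Inv b p = Synced p × ColoursWithin p T S × Mirrored b p

  AliceAnswers : Balance → Position → Set
  AliceAnswers b q = Inv b q ⊎ ∃[ f ] ∃[ c ] ∃[ r ] Step q f c r × Inv b r

  partner-distinct : ∀ {e f} → partner e ≡ just f → f ≢ e
  partner-distinct pe≡f refl with partner-crosses pe≡f
  ... | inj₁ (e∈S , e∈T) = S∩T≡∅ e∈S e∈T
  ... | inj₂ (e∈T , e∈S) = S∩T≡∅ e∈S e∈T

  module _ (T-paired : ∀ {e} → e ∈ T → Paired e) (S-fits : length (hub ∷ S) ≤ k) where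

    playable : ∀ b {p e} → Inv b p → p e ≡ nothing → ∃[ c ] Legal p e c
    playable b {e = e} (_ , within , _) pe≡nothing with split e
    ... | inj₁ refl         = star-S-playable within S-fits (here refl) pe≡nothing
    ... | inj₂ (inj₁ e∈S)   = star-S-playable within S-fits (there e∈S) pe≡nothing
    playable (balanced T-fits _) (_ , _ , mirrored) pe≡nothing | inj₂ (inj₂ e∈T) =
      Swapped.star-S-playable mirrored T-fits (there e∈T) pe≡nothing
    playable (unbalanced T<k) {p} {e} _ pe≡nothing | inj₂ (inj₂ e∈T) =
      legal-colour (rung e ?∷ hub ∷ T) (on-rung-list (there e∈T)) rung-list-fits pe≡nothing around
      where
      on-rung-list : ∀ {x} → x ∈ hub ∷ T → x ∈ rung e ?∷ hub ∷ T
      on-rung-list x∈ with rung e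
      ... | just _  = there x∈
      ... | nothing = x∈
      rung-list-fits : length (rung e ?∷ hub ∷ T) ≤ k
      rung-list-fits with rung e
      ... | just _  = T<k
      ... | nothing = <⇒≤ T<k
      around : ∀ {e′ d} → AdjE G e e′ → p e′ ≡ just d → just d ∈ map p (rung e ?∷ hub ∷ T)
      around e~e′ pe′≡d with adjacent e~e′
      ... | inj₁ (e∈ , _)                      = contradiction e∈T (hub∷S∌T e∈)
      ... | inj₂ (inj₁ (_ , e′∈))              = colour-on _ (on-rung-list e′∈) pe′≡d
      ... | inj₂ (inj₂ (rung≡ , _)) rewrite rung≡ = colour-on _ (here refl) pe′≡d

    module _ {p e c q} (step : Step p e c q) where

      synced-skip : partner e ≡ nothing → Synced p → Synced q
      synced-skip pe≡nothing synced {a} {b} pa≡b qa≡nothing =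
        trans (step-unchanged step b≢e) (synced pa≡b (proj₂ (step-blank step qa≡nothing)))
        where
        b≢e : b ≢ e
        b≢e refl = contradiction (trans (sym (partner-involutive pa≡b)) pe≡nothing) λ ()

      synced-pair : ∀ {f c′ r} → partner e ≡ just f → Step q f c′ r → Synced p → Synced r
      synced-pair {f} pe≡f step′ synced {a} {b} pa≡b ra≡nothing
        with step-blank step′ ra≡nothing
      ... | a≢f , qa≡nothing with step-blank step qa≡nothing
      ... | a≢e , pa≡nothing =
        trans (step-unchanged step′ b≢f) (trans (step-unchanged step b≢e) (synced pa≡b pa≡nothing))
        where
        b≢e : b ≢ e
        b≢e refl = a≢f (just-injective (trans (sym (partner-involutive pa≡b)) pe≡f))
        b≢f : b ≢ f
        b≢f refl = a≢e (just-injective (trans (sym (partner-involutive pa≡b)) (partner-involutive pe≡f)))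

      partner-blank : ∀ {f} → Synced p → partner e ≡ just f → q f ≡ nothing
      partner-blank synced pe≡f =
        trans (step-unchanged step (partner-distinct pe≡f)) (synced pe≡f (proj₁ (proj₁ step)))

      skip-keeps : ∀ b → partner e ≡ nothing → Inv b p → Inv b q
      skip-keeps b pe≡nothing (synced , within , mirrored) =
        synced-skip pe≡nothing synced ,
        within-step step (⊥-elim ∘ unpaired ∘ T-paired) within ,
        mirrored-step b mirrored
        where
        unpaired : ¬ Paired e
        unpaired (_ , pe≡f) = contradiction (trans (sym pe≡nothing) pe≡f) λ ()
        mirrored-step : ∀ b → Mirrored b p → Mirrored b q
        mirrored-step (balanced _ S-paired) = within-step step (⊥-elim ∘ unpaired ∘ S-paired)
        mirrored-step (unbalanced _)        = λ _ → tt

      mirror-keeps : ∀ b {f} → partner e ≡ just f → (legal : Legal q f c) → Inv b p →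
                     Inv b (colour q f c)
      mirror-keeps b {f} pe≡f legal (synced , within , mirrored) =
        synced-pair pe≡f step′ synced ,
        across (λ e∈T e∈S → S∩T≡∅ e∈S e∈T) (Sum.swap (partner-crosses pe≡f)) within ,
        mirrored-pair b mirrored
        where
        step′ = colour-step legal
        across : ∀ {A B} → (∀ {x} → x ∈ A → x ∉ B) → (e ∈ A × f ∈ B ⊎ e ∈ B × f ∈ A) →
                 ColoursWithin p A B → ColoursWithin (colour q f c) A B
        across {A} {B} A∌B sides = within-two-steps step step′ (new-e sides) (new-f sides)
          where
          new-e : e ∈ A × f ∈ B ⊎ e ∈ B × f ∈ A → e ∈ A → just c ∈ map (colour q f c) B
          new-e (inj₁ (_ , f∈B)) _   = colour-on B f∈B (proj₁ (proj₂ step′))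
          new-e (inj₂ (e∈B , _)) e∈A = contradiction e∈B (A∌B e∈A)
          new-f : e ∈ A × f ∈ B ⊎ e ∈ B × f ∈ A → f ∈ A → just c ∈ map (colour q f c) B
          new-f (inj₁ (_ , f∈B)) f∈A = contradiction f∈B (A∌B f∈A)
          new-f (inj₂ (e∈B , _)) _   = colour-on B e∈B (step-keeps step′ (proj₁ (proj₂ step)))
        mirrored-pair : ∀ b → Mirrored b p → Mirrored b (colour q f c)
        mirrored-pair (balanced _ _) = across S∩T≡∅ (partner-crosses pe≡f)
        mirrored-pair (unbalanced _) = λ _ → tt

      legal-mirror-into-T : ∀ b {f} → Inv b p → partner e ≡ just f → e ∈ S → f ∈ T → Legal q f c
      legal-mirror-into-T b {f} (synced , within , _) pe≡f e∈S f∈T =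
        partner-blank synced pe≡f , λ e″ e″≢f s → blocked (≢-sym e″≢f , s)
        where
        avoids : ∀ {x} → x ∈ hub ∷ S → x ≢ e → q x ≢ just c
        avoids x∈ x≢e qx≡c = star-S-avoids step (there e∈S) x∈ x≢e (step-unchanged-colour step x≢e qx≡c)
        blocked : ∀ {e″} → AdjE G f e″ → q e″ ≢ just c
        blocked f~e″ qe″≡c with adjacent f~e″
        ... | inj₁ (f∈ , _)                       = hub∷S∌T f∈ f∈T
        ... | inj₂ (inj₁ (_ , here refl))         = avoids (here refl) (λ { refl → hub∉S e∈S }) qe″≡c
        ... | inj₂ (inj₁ (_ , there e″∈T))
          with ∈-map⁻ p (within e″∈T (step-unchanged-colour step (λ { refl → S∩T≡∅ e∈S e″∈T }) qe″≡c))
        ...   | x , x∈S , c≡px =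
          star-S-avoids step (there e∈S) (there x∈S)
            (coloured≢blank (sym c≡px) (proj₁ (proj₁ step))) (sym c≡px)
        blocked f~e″ qe″≡c | inj₂ (inj₂ (_ , inj₁ (f∈S , _)))         = S∩T≡∅ f∈S f∈T
        blocked f~e″ qe″≡c | inj₂ (inj₂ (rung≡ , inj₂ (_ , e″∈S))) =
          avoids (there e″∈S) (λ { refl → partner-not-rung (partner-involutive pe≡f) rung≡ }) qe″≡c

      legal-mirror-into-S : ∀ b {f} → Inv b p → partner e ≡ just f → e ∈ T → f ∈ S →
                            just c ∉ map p S → Legal q f c
      legal-mirror-into-S b {f} (synced , _ , _) pe≡f e∈T f∈S c∉S =
        partner-blank synced pe≡f , λ e″ e″≢f s → blocked (≢-sym e″≢f , s)
        where
        avoids : ∀ {x} → x ∈ hub ∷ T → x ≢ e → q x ≢ just c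
        avoids x∈ x≢e qx≡c =
          Swapped.star-S-avoids step (there e∈T) x∈ x≢e (step-unchanged-colour step x≢e qx≡c)
        blocked : ∀ {e″} → AdjE G f e″ → q e″ ≢ just c
        blocked f~e″ qe″≡c with adjacent f~e″
        ... | inj₁ (_ , here refl)                 = avoids (here refl) (λ { refl → hub∉T e∈T }) qe″≡c
        ... | inj₁ (_ , there e″∈S)                =
          c∉S (colour-on S e″∈S (step-unchanged-colour step (λ { refl → S∩T≡∅ e″∈S e∈T }) qe″≡c))
        ... | inj₂ (inj₁ (f∈ , _))                 = hub∷T∌S f∈ f∈S
        ... | inj₂ (inj₂ (rung≡ , inj₁ (_ , e″∈T))) =
          avoids (there e″∈T) (λ { refl → partner-not-rung (partner-involutive pe≡f) rung≡ }) qe″≡c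
        ... | inj₂ (inj₂ (_ , inj₂ (f∈T , _)))     = S∩T≡∅ f∈S f∈T

      -- When balanced, the colour c of the T-edge e would already sit on T next to e. Otherwise
      -- c is already on S, so any legal colour on the partner keeps the invariant.
      reused-colour : ∀ b {f} → Inv b p → partner e ≡ just f → e ∈ T → f ∈ S → just c ∈ map p S →
                      AliceAnswers b q
      reused-colour (balanced _ _) (_ , _ , mirrored) _ e∈T _ c∈S with ∈-map⁻ p c∈S
      ... | x , x∈S , c≡px with ∈-map⁻ p (mirrored x∈S (sym c≡px))
      ... | y , y∈T , c≡py = ⊥-elim
        (Swapped.star-S-avoids step (there e∈T) (there y∈T)
           (coloured≢blank (sym c≡py) (proj₁ (proj₁ step))) (sym c≡py))
      reused-colour (unbalanced T<k) {f} (synced , within , _) pe≡f e∈T f∈S c∈S =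
        answer (star-S-playable within′ S-fits (there f∈S) (partner-blank synced pe≡f))
        where
        within′ : ColoursWithin q T S
        within′ = within-step step (λ _ → step-keeps-colour-on step S c∈S) within
        answer : ∃[ c′ ] Legal q f c′ → AliceAnswers (unbalanced T<k) q
        answer (c′ , legal) = inj₂ (f , c′ , colour q f c′ , colour-step legal ,
                                    synced-pair pe≡f (colour-step legal) synced ,
                                    within-step (colour-step legal) (⊥-elim ∘ S∩T≡∅ f∈S) within′ , tt)

      mirror : ∀ b {f} → partner e ≡ just f → Legal q f c → Inv b p → AliceAnswers b q
      mirror b {f} pe≡f legal inv =
        inj₂ (f , c , colour q f c , colour-step legal , mirror-keeps b pe≡f legal inv)

      respond : ∀ b → Inv b p → AliceAnswers b q
      respond b inv with partner e in pe≡
      ... | nothing = inj₁ (skip-keeps b pe≡ inv)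
      ... | just f with partner-crosses pe≡
      ...   | inj₁ (e∈S , f∈T) = mirror b pe≡ (legal-mirror-into-T b inv pe≡ e∈S f∈T) inv
      ...   | inj₂ (e∈T , f∈S) with just c ∈? map p S
      ...     | yes c∈S = reused-colour b inv pe≡ e∈T f∈S c∈S
      ...     | no  c∉S = mirror b pe≡ (legal-mirror-into-S b inv pe≡ e∈T f∈S c∉S) inv

    aliceWins : Balance → AliceWins G k
    aliceWins b = Invariant.aliceWins-from (Inv b) (playable b) (λ inv step → respond step b inv) initial
      where
      initial : Inv b empty
      initial = (λ _ _ → refl) , (λ _ ()) , mirrored b
        where
        mirrored : ∀ b → Mirrored b empty
        mirrored (balanced _ _) _ ()
        mirrored (unbalanced _) = tt

module Cliques (G : Graph) (_≟_ : DecidableEquality (Graph.Edge G)) (X : TwoStars G) where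
  open Graph G
  open TwoStars X
  open DecMembership _≟_ using (_∈?_)

  ω : ℕ
  ω = 3 ⊔ (length (hub ∷ S) ⊔ length (hub ∷ T))

  3≤ω : 3 ≤ ω
  3≤ω = m≤m⊔n 3 (length (hub ∷ S) ⊔ length (hub ∷ T))

  star-S≤ω : length (hub ∷ S) ≤ ω
  star-S≤ω = ≤-trans (m≤m⊔n (length (hub ∷ S)) (length (hub ∷ T)))
                     (m≤n⊔m 3 (length (hub ∷ S) ⊔ length (hub ∷ T)))

  star-T≤ω : length (hub ∷ T) ≤ ω
  star-T≤ω = ≤-trans (m≤n⊔m (length (hub ∷ S)) (length (hub ∷ T)))
                     (m≤n⊔m 3 (length (hub ∷ S) ⊔ length (hub ∷ T)))

  stars-meet-at-hub : ∀ {e} → e ∈ hub ∷ S → e ∈ hub ∷ T → e ≡ hub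
  stars-meet-at-hub (here refl) _  = refl
  stars-meet-at-hub (there e∈S) e∈ = contradiction e∈S (hub∷T∌S e∈)

  beside-T : ∀ {a x} → AdjE G a x → a ∉ hub ∷ S → rung a ≢ just x → x ∈ hub ∷ T
  beside-T a~x a∉ not-rung with adjacent a~x
  ... | inj₁ (a∈ , _)           = contradiction a∈ a∉
  ... | inj₂ (inj₁ (_ , x∈))    = x∈
  ... | inj₂ (inj₂ (rung≡ , _)) = contradiction rung≡ not-rung

  beside-S : ∀ {a x} → AdjE G a x → a ∉ hub ∷ T → rung a ≢ just x → x ∈ hub ∷ S
  beside-S a~x a∉ not-rung with adjacent a~x
  ... | inj₁ (_ , x∈)           = x∈
  ... | inj₂ (inj₁ (a∈ , _))    = contradiction a∈ a∉
  ... | inj₂ (inj₂ (rung≡ , _)) = contradiction rung≡ not-rung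

  rung-between : ∀ {a b} → AdjE G a b → a ∉ hub ∷ S → b ∉ hub ∷ T → rung a ≡ just b
  rung-between a~b a∉ b∉ with adjacent a~b
  ... | inj₁ (a∈ , _)           = contradiction a∈ a∉
  ... | inj₂ (inj₁ (_ , b∈))    = contradiction b∈ b∉
  ... | inj₂ (inj₂ (rung≡ , _)) = rung≡

  -- A clique that leaves both stars contains an edge z off the first star and an edge z′ off
  -- the second; they must form a rung, and every further edge of the clique lies on both stars.
  clique-length-≤ : ∀ {xs} → LineClique G xs → length xs ≤ ω
  clique-length-≤ {xs} clique with all? (_∈? hub ∷ S) xs | all? (_∈? hub ∷ T) xs
  ... | yes ⊆S | _      = ≤-trans (unique-⊆⇒length-≤ (AllPairs.map proj₁ clique) (All.lookup ⊆S)) star-S≤ω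
  ... | no _   | yes ⊆T = ≤-trans (unique-⊆⇒length-≤ (AllPairs.map proj₁ clique) (All.lookup ⊆T)) star-T≤ω
  ... | no ⊈S  | no ⊈T
    with find (¬All⇒Any¬ (_∈? hub ∷ S) xs ⊈S) | find (¬All⇒Any¬ (_∈? hub ∷ T) xs ⊈T)
  ... | z , z∈xs , z∉ | z′ , z′∈xs , z′∉ =
    ≤-trans (unique-⊆⇒length-≤ (AllPairs.map proj₁ clique) ⊆triangle) 3≤ω
    where
    z≢z′ : z ≢ z′
    z≢z′ refl with split z
    ... | inj₁ refl       = z∉ (here refl)
    ... | inj₂ (inj₁ z∈S) = z∉ (there z∈S)
    ... | inj₂ (inj₂ z∈T) = z′∉ (there z∈T)
    rung-z : rung z ≡ just z′
    rung-z = rung-between (clique-adjacent G clique z∈xs z′∈xs z≢z′) z∉ z′∉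
    rung-z′ : rung z′ ≡ just z
    rung-z′ with adjacent (clique-adjacent G clique z′∈xs z∈xs (≢-sym z≢z′))
    ... | inj₁ (_ , z∈)           = contradiction z∈ z∉
    ... | inj₂ (inj₁ (z′∈ , _))   = contradiction z′∈ z′∉
    ... | inj₂ (inj₂ (rung≡ , _)) = rung≡
    ⊆triangle : ∀ {x} → x ∈ xs → x ∈ hub ∷ z ∷ z′ ∷ []
    ⊆triangle {x} x∈xs with x ≟ z | x ≟ z′
    ... | yes refl | _        = there (here refl)
    ... | no _     | yes refl = there (there (here refl))
    ... | no x≢z   | no x≢z′  = here (stars-meet-at-hub
      (beside-S (clique-adjacent G clique z′∈xs x∈xs (≢-sym x≢z′)) z′∉
                (λ rung≡ → x≢z (just-injective (trans (sym rung≡) rung-z′))))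
      (beside-T (clique-adjacent G clique z∈xs x∈xs (≢-sym x≢z)) z∉
                (λ rung≡ → x≢z′ (just-injective (trans (sym rung≡) rung-z)))))

module StarBook (m n₁ n₂ : ℕ) where

  G : Graph
  G = starBook m n₁ n₂

  Edge : Set
  Edge = SBEdge m n₁ n₂

  _≟_ : DecidableEquality Edge
  e₁₂   ≟ e₁₂   = yes refl
  e₁w i ≟ e₁w j = map′ (cong e₁w) (λ { refl → refl }) (i ≟ᶠ j)
  e₂w i ≟ e₂w j = map′ (cong e₂w) (λ { refl → refl }) (i ≟ᶠ j)
  e₁ℓ i ≟ e₁ℓ j = map′ (cong e₁ℓ) (λ { refl → refl }) (i ≟ᶠ j)
  e₂ℓ i ≟ e₂ℓ j = map′ (cong e₂ℓ) (λ { refl → refl }) (i ≟ᶠ j)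
  e₁₂   ≟ e₁w _ = no λ ()
  e₁₂   ≟ e₂w _ = no λ ()
  e₁₂   ≟ e₁ℓ _ = no λ ()
  e₁₂   ≟ e₂ℓ _ = no λ ()
  e₁w _ ≟ e₁₂   = no λ ()
  e₁w _ ≟ e₂w _ = no λ ()
  e₁w _ ≟ e₁ℓ _ = no λ ()
  e₁w _ ≟ e₂ℓ _ = no λ ()
  e₂w _ ≟ e₁₂   = no λ ()
  e₂w _ ≟ e₁w _ = no λ ()
  e₂w _ ≟ e₁ℓ _ = no λ ()
  e₂w _ ≟ e₂ℓ _ = no λ ()
  e₁ℓ _ ≟ e₁₂   = no λ ()
  e₁ℓ _ ≟ e₁w _ = no λ ()
  e₁ℓ _ ≟ e₂w _ = no λ ()
  e₁ℓ _ ≟ e₂ℓ _ = no λ ()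
  e₂ℓ _ ≟ e₁₂   = no λ ()
  e₂ℓ _ ≟ e₁w _ = no λ ()
  e₂ℓ _ ≟ e₂w _ = no λ ()
  e₂ℓ _ ≟ e₁ℓ _ = no λ ()

  side₁ side₂ star₁ star₂ allEdges : List Edge
  side₁    = map e₁w (allFin m) ++ map e₁ℓ (allFin n₁)
  side₂    = map e₂w (allFin m) ++ map e₂ℓ (allFin n₂)
  star₁    = e₁₂ ∷ side₁
  star₂    = e₁₂ ∷ side₂
  allEdges = e₁₂ ∷ side₁ ++ side₂

  data Spoke₁ : Edge → Set where
    page    : ∀ i → Spoke₁ (e₁w i)
    pendant : ∀ j → Spoke₁ (e₁ℓ j)

  data Spoke₂ : Edge → Set where
    page    : ∀ i → Spoke₂ (e₂w i)
    pendant : ∀ j → Spoke₂ (e₂ℓ j)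

  spoke₁∈ : ∀ {e} → Spoke₁ e → e ∈ side₁
  spoke₁∈ (page i)    = ∈-++⁺ˡ (∈-map⁺ e₁w (∈-allFin i))
  spoke₁∈ (pendant j) = ∈-++⁺ʳ (map e₁w (allFin m)) (∈-map⁺ e₁ℓ (∈-allFin j))

  spoke₂∈ : ∀ {e} → Spoke₂ e → e ∈ side₂
  spoke₂∈ (page i)    = ∈-++⁺ˡ (∈-map⁺ e₂w (∈-allFin i))
  spoke₂∈ (pendant j) = ∈-++⁺ʳ (map e₂w (allFin m)) (∈-map⁺ e₂ℓ (∈-allFin j))

  ∈side₁⇒spoke : ∀ {e} → e ∈ side₁ → Spoke₁ e
  ∈side₁⇒spoke e∈ with ∈-++⁻ (map e₁w (allFin m)) e∈
  ... | inj₁ e∈pages    with ∈-map⁻ e₁w e∈pages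
  ...   | i , _ , refl = page i
  ∈side₁⇒spoke e∈ | inj₂ e∈pendants with ∈-map⁻ e₁ℓ e∈pendants
  ...   | j , _ , refl = pendant j

  ∈side₂⇒spoke : ∀ {e} → e ∈ side₂ → Spoke₂ e
  ∈side₂⇒spoke e∈ with ∈-++⁻ (map e₂w (allFin m)) e∈
  ... | inj₁ e∈pages    with ∈-map⁻ e₂w e∈pages
  ...   | i , _ , refl = page i
  ∈side₂⇒spoke e∈ | inj₂ e∈pendants with ∈-map⁻ e₂ℓ e∈pendants
  ...   | j , _ , refl = pendant j

  split : ∀ e → e ≡ e₁₂ ⊎ e ∈ side₁ ⊎ e ∈ side₂
  split e₁₂     = inj₁ refl
  split (e₁w i) = inj₂ (inj₁ (spoke₁∈ (page i)))
  split (e₂w i) = inj₂ (inj₂ (spoke₂∈ (page i)))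
  split (e₁ℓ j) = inj₂ (inj₁ (spoke₁∈ (pendant j)))
  split (e₂ℓ j) = inj₂ (inj₂ (spoke₂∈ (pendant j)))

  allEdges-complete : ∀ e → e ∈ allEdges
  allEdges-complete e with split e
  ... | inj₁ refl        = here refl
  ... | inj₂ (inj₁ e∈₁) = there (∈-++⁺ˡ e∈₁)
  ... | inj₂ (inj₂ e∈₂) = there (∈-++⁺ʳ side₁ e∈₂)

  star₁⇒through : ∀ {e} → e ∈ star₁ → Through G v₁ e
  star₁⇒through (here refl) = first refl
  star₁⇒through (there e∈) with ∈side₁⇒spoke e∈
  ... | page _    = first refl
  ... | pendant _ = first refl

  star₂⇒through : ∀ {e} → e ∈ star₂ → Through G v₂ e
  star₂⇒through (here refl) = second refl
  star₂⇒through (there e∈) with ∈side₂⇒spoke e∈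
  ... | page _    = first refl
  ... | pendant _ = first refl

  data At : SBVtx m n₁ n₂ → Edge → Set where
    at-v₁    : ∀ {e} → e ∈ star₁ → At v₁ e
    at-v₂    : ∀ {e} → e ∈ star₂ → At v₂ e
    at-w₁    : ∀ i → At (w i) (e₁w i)
    at-w₂    : ∀ i → At (w i) (e₂w i)
    at-leaf₁ : ∀ j → At (leaf₁ j) (e₁ℓ j)
    at-leaf₂ : ∀ j → At (leaf₂ j) (e₂ℓ j)

  through⇒at : ∀ {u e} → Through G u e → At u e
  through⇒at {e = e₁₂}   (first refl)  = at-v₁ (here refl)
  through⇒at {e = e₁₂}   (second refl) = at-v₂ (here refl)
  through⇒at {e = e₁w i} (first refl)  = at-v₁ (there (spoke₁∈ (page i)))
  through⇒at {e = e₁w i} (second refl) = at-w₁ i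
  through⇒at {e = e₂w i} (first refl)  = at-v₂ (there (spoke₂∈ (page i)))
  through⇒at {e = e₂w i} (second refl) = at-w₂ i
  through⇒at {e = e₁ℓ j} (first refl)  = at-v₁ (there (spoke₁∈ (pendant j)))
  through⇒at {e = e₁ℓ j} (second refl) = at-leaf₁ j
  through⇒at {e = e₂ℓ j} (first refl)  = at-v₂ (there (spoke₂∈ (pendant j)))
  through⇒at {e = e₂ℓ j} (second refl) = at-leaf₂ j

  rung : Edge → Maybe Edge
  rung (e₁w i) = just (e₂w i)
  rung (e₂w i) = just (e₁w i)
  rung _       = nothing

  book : TwoStars G
  book = record
    { hub = e₁₂ ; S = side₁ ; T = side₂
    ; hub∉S = λ e₁₂∈ → case ∈side₁⇒spoke e₁₂∈ of λ ()
    ; hub∉T = λ e₁₂∈ → case ∈side₂⇒spoke e₁₂∈ of λ ()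
    ; S∩T≡∅ = λ e∈₁ e∈₂ → disjoint (∈side₁⇒spoke e∈₁) (∈side₂⇒spoke e∈₂)
    ; split = split
    ; star-S = λ x∈ y∈ → through⇒shareEnd G (star₁⇒through x∈) (star₁⇒through y∈)
    ; star-T = λ x∈ y∈ → through⇒shareEnd G (star₂⇒through x∈) (star₂⇒through y∈)
    ; rung = rung
    ; adjacent = adjacent
    }
    where
    disjoint : ∀ {e} → Spoke₁ e → ¬ Spoke₂ e
    disjoint (page _)    ()
    disjoint (pendant _) ()
    adjacent : ∀ {e e′} → AdjE G e e′ →
               (e ∈ star₁ × e′ ∈ star₁) ⊎ (e ∈ star₂ × e′ ∈ star₂) ⊎
               (rung e ≡ just e′ × (e ∈ side₁ × e′ ∈ side₂ ⊎ e ∈ side₂ × e′ ∈ side₁))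
    adjacent {e} {e′} (e≢e′ , s) with shareEnd⇒through G s
    ... | _ , t , t′ with through⇒at t | through⇒at t′
    ... | at-v₁ e∈     | at-v₁ e′∈     = inj₁ (e∈ , e′∈)
    ... | at-v₂ e∈     | at-v₂ e′∈     = inj₂ (inj₁ (e∈ , e′∈))
    ... | at-w₁ i      | at-w₂ .i      = inj₂ (inj₂ (refl , inj₁ (spoke₁∈ (page i) , spoke₂∈ (page i))))
    ... | at-w₂ i      | at-w₁ .i      = inj₂ (inj₂ (refl , inj₂ (spoke₂∈ (page i) , spoke₁∈ (page i))))
    ... | at-w₁ _      | at-w₁ _       = contradiction refl e≢e′
    ... | at-w₂ _      | at-w₂ _       = contradiction refl e≢e′
    ... | at-leaf₁ _   | at-leaf₁ _    = contradiction refl e≢e′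
    ... | at-leaf₂ _   | at-leaf₂ _    = contradiction refl e≢e′

  record BookPairing : Set where
    field
      pairing : Pairing book
    open Pairing pairing
    field
      side₁-paired : n₁ ≤ n₂ → ∀ {e} → e ∈ side₁ → ∃[ f ] partner e ≡ just f
      side₂-paired : n₂ ≤ n₁ → ∀ {e} → e ∈ side₂ → ∃[ f ] partner e ≡ just f

  open Cliques G _≟_ book public using (ω; star-S≤ω; star-T≤ω; clique-length-≤)

  private
    length-side : ∀ {a b} (f : Fin a → Edge) (g : Fin b → Edge) →
                  length (map f (allFin a) ++ map g (allFin b)) ≡ a + b
    length-side {a} {b} f g = trans (length-++ (map f (allFin a)))
      (cong₂ _+_ (trans (length-map f (allFin a)) (length-tabulate {n = a} (λ i → i)))
                 (trans (length-map g (allFin b)) (length-tabulate {n = b} (λ j → j))))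

    unique-side : ∀ {a b} (f : Fin a → Edge) (g : Fin b → Edge) →
                  (∀ {i j} → f i ≡ f j → i ≡ j) → (∀ {i j} → g i ≡ g j → i ≡ j) → (∀ {i j} → f i ≢ g j) →
                  Unique (map f (allFin a) ++ map g (allFin b))
    unique-side {a} {b} f g f-inj g-inj f≢g =
      Unique.++⁺ (Unique.map⁺ f-inj (Unique.allFin⁺ a)) (Unique.map⁺ g-inj (Unique.allFin⁺ b)) disjoint
      where
      disjoint : ∀ {e} → ¬ (e ∈ map f (allFin a) × e ∈ map g (allFin b))
      disjoint (e∈f , e∈g) with ∈-map⁻ f e∈f | ∈-map⁻ g e∈g
      ... | _ , _ , refl | _ , _ , fi≡gj = f≢g fi≡gj

  length-star₁ : length star₁ ≡ suc (m + n₁)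
  length-star₁ = cong suc (length-side e₁w e₁ℓ)

  length-star₂ : length star₂ ≡ suc (m + n₂)
  length-star₂ = cong suc (length-side e₂w e₂ℓ)

  star₁<star₂ : n₁ < n₂ → length star₁ < length star₂
  star₁<star₂ n₁<n₂ rewrite length-star₁ | length-star₂ = s≤s (+-monoʳ-< m n₁<n₂)

  star₂<star₁ : n₂ < n₁ → length star₂ < length star₁
  star₂<star₁ n₂<n₁ rewrite length-star₁ | length-star₂ = s≤s (+-monoʳ-< m n₂<n₁)

  star₁-clique : LineClique G star₁
  star₁-clique = unique-star⇒clique G
    (All.tabulate (λ e∈ e₁₂≡e → TwoStars.hub∉S book (subst (_∈ side₁) (sym e₁₂≡e) e∈)) ∷
     unique-side e₁w e₁ℓ (λ { refl → refl }) (λ { refl → refl }) λ ())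
    (TwoStars.star-S book)

  star₂-clique : LineClique G star₂
  star₂-clique = unique-star⇒clique G
    (All.tabulate (λ e∈ e₁₂≡e → TwoStars.hub∉T book (subst (_∈ side₂) (sym e₁₂≡e) e∈)) ∷
     unique-side e₂w e₂ℓ (λ { refl → refl }) (λ { refl → refl }) λ ())
    (TwoStars.star-T book)

  triangle-clique : (i : Fin m) → LineClique G (e₁₂ ∷ e₁w i ∷ e₂w i ∷ [])
  triangle-clique i =
    (((λ ()) , through⇒shareEnd G {v₁} {e₁₂} {e₁w i} (first refl) (first refl)) ∷
     ((λ ()) , through⇒shareEnd G {v₂} {e₁₂} {e₂w i} (second refl) (first refl)) ∷ []) ∷
    (((λ ()) , through⇒shareEnd G {w i} {e₁w i} {e₂w i} (second refl) (second refl)) ∷ []) ∷ [] ∷ []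

  clique-of-size-ω : Fin m → ∃[ xs ] LineClique G xs × length xs ≡ ω
  clique-of-size-ω i with ⊔-sel 3 (length star₁ ⊔ length star₂)
  ... | inj₁ ω≡3 = _ , triangle-clique i , sym ω≡3
  ... | inj₂ ω≡  with ⊔-sel (length star₁) (length star₂)
  ...   | inj₁ ≡star₁ = star₁ , star₁-clique , sym (trans ω≡ ≡star₁)
  ...   | inj₂ ≡star₂ = star₂ , star₂-clique , sym (trans ω≡ ≡star₂)

  module Mirrorω = Mirror G _≟_ allEdges allEdges-complete ω

  aliceWins-paired : BookPairing → AliceWins G ω
  aliceWins-paired P with n₂ ≤? n₁
  ... | yes n₂≤n₁ = Mirrorω.aliceWins book pairing (side₂-paired n₂≤n₁) star-S≤ω
                                      (balance (m≤n⇒m<n∨m≡n n₂≤n₁))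
    where
    open BookPairing P
    balance : n₂ < n₁ ⊎ n₂ ≡ n₁ → Mirrorω.Balance book pairing
    balance (inj₁ n₂<n₁) = Mirrorω.unbalanced (<-≤-trans (star₂<star₁ n₂<n₁) star-S≤ω)
    balance (inj₂ refl)  = Mirrorω.balanced star-T≤ω (side₁-paired ≤-refl)
  ... | no n₂≰n₁ = Mirrorω.aliceWins (TwoStars.swap book) (Pairing.swapᵖ pairing)
                                     (side₁-paired (<⇒≤ (≰⇒> n₂≰n₁))) star-T≤ω
                                     (Mirrorω.unbalanced (<-≤-trans (star₁<star₂ (≰⇒> n₂≰n₁)) star-T≤ω))
    where
    open BookPairing P

module PagesPairing (m n₁ n₂ : ℕ) where
  open StarBook (suc (suc m)) n₁ n₂

  partner : Edge → Maybe Edge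
  partner e₁₂     = nothing
  partner (e₁w i) = just (e₂w (next i))
  partner (e₂w i) = just (e₁w (prev i))
  partner (e₁ℓ j) = matchIndex e₂ℓ j
  partner (e₂ℓ j) = matchIndex e₁ℓ j

  involutive : ∀ {a b} → partner a ≡ just b → partner b ≡ just a
  involutive {e₁w i} refl = cong (just ∘ e₁w) (prev-next i)
  involutive {e₂w i} refl = cong (just ∘ e₂w) (next-prev i)
  involutive {e₁ℓ j} eq with matchIndex-just e₂ℓ eq
  ... | _ , j≡j′ , refl = matchIndex-of e₁ℓ (sym j≡j′)
  involutive {e₂ℓ j} eq with matchIndex-just e₁ℓ eq
  ... | _ , j≡j′ , refl = matchIndex-of e₂ℓ (sym j≡j′)

  crosses : ∀ {a b} → partner a ≡ just b → a ∈ side₁ × b ∈ side₂ ⊎ a ∈ side₂ × b ∈ side₁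
  crosses {e₁w i} refl = inj₁ (spoke₁∈ (page i) , spoke₂∈ (page (next i)))
  crosses {e₂w i} refl = inj₂ (spoke₂∈ (page i) , spoke₁∈ (page (prev i)))
  crosses {e₁ℓ j} eq with matchIndex-just e₂ℓ eq
  ... | j′ , _ , refl = inj₁ (spoke₁∈ (pendant j) , spoke₂∈ (pendant j′))
  crosses {e₂ℓ j} eq with matchIndex-just e₁ℓ eq
  ... | j′ , _ , refl = inj₂ (spoke₂∈ (pendant j) , spoke₁∈ (pendant j′))

  not-rung : ∀ {a b} → partner a ≡ just b → rung a ≢ just b
  not-rung {e₁w i} refl rung≡ = next-≢ i (sym (page-injective (just-injective rung≡)))
    where
    page-injective : ∀ {i j} → e₂w i ≡ e₂w j → i ≡ j
    page-injective refl = refl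
  not-rung {e₂w i} refl rung≡ =
    next-≢ i (trans (cong next (page-injective (just-injective rung≡))) (next-prev i))
    where
    page-injective : ∀ {i j} → e₁w i ≡ e₁w j → i ≡ j
    page-injective refl = refl
  not-rung {e₁ℓ _} _ ()
  not-rung {e₂ℓ _} _ ()

  bookPairing : BookPairing
  bookPairing = record
    { pairing = record { partner = partner ; partner-involutive = involutive
                       ; partner-crosses = crosses ; partner-not-rung = not-rung }
    ; side₁-paired = λ n₁≤n₂ e∈ → paired₁ n₁≤n₂ (∈side₁⇒spoke e∈)
    ; side₂-paired = λ n₂≤n₁ e∈ → paired₂ n₂≤n₁ (∈side₂⇒spoke e∈)
    }
    where
    paired₁ : n₁ ≤ n₂ → ∀ {e} → Spoke₁ e → ∃[ f ] partner e ≡ just f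
    paired₁ _     (page _)    = _ , refl
    paired₁ n₁≤n₂ (pendant j) = matchIndex-total e₂ℓ (<-≤-trans (toℕ<n j) n₁≤n₂)
    paired₂ : n₂ ≤ n₁ → ∀ {e} → Spoke₂ e → ∃[ f ] partner e ≡ just f
    paired₂ _     (page _)    = _ , refl
    paired₂ n₂≤n₁ (pendant j) = matchIndex-total e₁ℓ (<-≤-trans (toℕ<n j) n₂≤n₁)

-- With a single page the two page edges are adjacent, so each is paired with the first
-- pendant edge on the other side and the remaining pendant edges are matched by index.
module OnePagePairing (n₁ n₂ : ℕ) (has-pendant : 1 ≤ n₁ ⊔ n₂) where
  open StarBook 1 n₁ n₂

  partner : Edge → Maybe Edge
  partner e₁₂           = nothing
  partner (e₁w i)       = matchIndex e₂ℓ i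
  partner (e₂w i)       = matchIndex e₁ℓ i
  partner (e₁ℓ zero)    = just (e₂w zero)
  partner (e₁ℓ (suc j)) = matchIndex e₂ℓ (suc j)
  partner (e₂ℓ zero)    = just (e₁w zero)
  partner (e₂ℓ (suc j)) = matchIndex e₁ℓ (suc j)

  involutive : ∀ {a b} → partner a ≡ just b → partner b ≡ just a
  involutive {e₁w zero} eq with matchIndex-just e₂ℓ eq
  ... | zero , _ , refl = refl
  involutive {e₂w zero} eq with matchIndex-just e₁ℓ eq
  ... | zero , _ , refl = refl
  involutive {e₁ℓ zero} refl = matchIndex-of {a = 1} e₁ℓ refl
  involutive {e₂ℓ zero} refl = matchIndex-of {a = 1} e₂ℓ refl
  involutive {e₁ℓ (suc j)} eq with matchIndex-just e₂ℓ eq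
  ... | suc _ , j≡j′ , refl = matchIndex-of e₁ℓ (sym j≡j′)
  involutive {e₂ℓ (suc j)} eq with matchIndex-just e₁ℓ eq
  ... | suc _ , j≡j′ , refl = matchIndex-of e₂ℓ (sym j≡j′)

  crosses : ∀ {a b} → partner a ≡ just b → a ∈ side₁ × b ∈ side₂ ⊎ a ∈ side₂ × b ∈ side₁
  crosses {e₁w i} eq with matchIndex-just e₂ℓ eq
  ... | j′ , _ , refl = inj₁ (spoke₁∈ (page i) , spoke₂∈ (pendant j′))
  crosses {e₂w i} eq with matchIndex-just e₁ℓ eq
  ... | j′ , _ , refl = inj₂ (spoke₂∈ (page i) , spoke₁∈ (pendant j′))
  crosses {e₁ℓ zero} refl = inj₁ (spoke₁∈ (pendant zero) , spoke₂∈ (page zero))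
  crosses {e₂ℓ zero} refl = inj₂ (spoke₂∈ (pendant zero) , spoke₁∈ (page zero))
  crosses {e₁ℓ (suc j)} eq with matchIndex-just e₂ℓ eq
  ... | j′ , _ , refl = inj₁ (spoke₁∈ (pendant (suc j)) , spoke₂∈ (pendant j′))
  crosses {e₂ℓ (suc j)} eq with matchIndex-just e₁ℓ eq
  ... | j′ , _ , refl = inj₂ (spoke₂∈ (pendant (suc j)) , spoke₁∈ (pendant j′))

  not-rung : ∀ {a b} → partner a ≡ just b → rung a ≢ just b
  not-rung {e₁w i} eq with matchIndex-just e₂ℓ eq
  ... | _ , _ , refl = λ ()
  not-rung {e₂w i} eq with matchIndex-just e₁ℓ eq
  ... | _ , _ , refl = λ ()
  not-rung {e₁ℓ _} _ ()
  not-rung {e₂ℓ _} _ ()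

  bookPairing : BookPairing
  bookPairing = record
    { pairing = record { partner = partner ; partner-involutive = involutive
                       ; partner-crosses = crosses ; partner-not-rung = not-rung }
    ; side₁-paired = λ n₁≤n₂ e∈ → paired₁ n₁≤n₂ (∈side₁⇒spoke e∈)
    ; side₂-paired = λ n₂≤n₁ e∈ → paired₂ n₂≤n₁ (∈side₂⇒spoke e∈)
    }
    where
    paired₁ : n₁ ≤ n₂ → ∀ {e} → Spoke₁ e → ∃[ f ] partner e ≡ just f
    paired₁ n₁≤n₂ (page zero)       = matchIndex-total e₂ℓ (subst (1 ≤_) (m≤n⇒m⊔n≡n n₁≤n₂) has-pendant)
    paired₁ _     (pendant zero)    = _ , refl
    paired₁ n₁≤n₂ (pendant (suc j)) = matchIndex-total e₂ℓ (<-≤-trans (toℕ<n (suc j)) n₁≤n₂)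
    paired₂ : n₂ ≤ n₁ → ∀ {e} → Spoke₂ e → ∃[ f ] partner e ≡ just f
    paired₂ n₂≤n₁ (page zero)       = matchIndex-total e₁ℓ (subst (1 ≤_) (m≥n⇒m⊔n≡m n₂≤n₁) has-pendant)
    paired₂ _     (pendant zero)    = _ , refl
    paired₂ n₂≤n₁ (pendant (suc j)) = matchIndex-total e₁ℓ (<-≤-trans (toℕ<n (suc j)) n₂≤n₁)

aliceWins-ω : ∀ m n₁ n₂ → 1 ≤ m → AliceWins (starBook m n₁ n₂) (StarBook.ω m n₁ n₂)
aliceWins-ω 1 0 0 _ = Moves.Play.aliceWins-few-edges G _≟_ 3 allEdges allEdges-complete ≤-refl
  where open StarBook 1 0 0
aliceWins-ω 1 (suc n₁) n₂ _ = StarBook.aliceWins-paired 1 (suc n₁) n₂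
  (OnePagePairing.bookPairing (suc n₁) n₂ (≤-trans (s≤s z≤n) (m≤m⊔n (suc n₁) n₂)))
aliceWins-ω 1 0 (suc n₂) _ = StarBook.aliceWins-paired 1 0 (suc n₂)
  (OnePagePairing.bookPairing 0 (suc n₂) (s≤s z≤n))
aliceWins-ω (suc (suc m)) n₁ n₂ _ =
  StarBook.aliceWins-paired (suc (suc m)) n₁ n₂ (PagesPairing.bookPairing m n₁ n₂)

lemma64 : (m n₁ n₂ : ℕ) → 1 ≤ m → LineBANice (starBook m n₁ n₂)
lemma64 (suc m) n₁ n₂ 1≤m =
  ω , (clique-of-size-ω zero , λ _ → clique-length-≤) , aliceWins-ω (suc m) n₁ n₂ 1≤m , no-smaller-win
  where
  open StarBook (suc m) n₁ n₂
  no-smaller-win : ∀ k → k < ω → ¬ AliceWins G k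
  no-smaller-win k k<ω with clique-of-size-ω zero
  ... | _ , clique , length≡ω = Moves.no-win-below-clique G _≟_ k clique (subst (k <_) (sym length≡ω) k<ω)
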